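{- There exists a $20$-dimensional lattice polytope $P\subseteq\mathbb{R}^{20}$ whose $h^2$-tensor polynomial has a coefficient that is not positive semi-definite.
   Context: For a lattice polytope $P\subseteq\mathbb{R}^d$ of dimension $D$ let $L^2(P)=\sum_{x\in P\cap\mathbb{Z}^d}xx^T$ (a symmetric $d\times d$ matrix). The $h^2$-tensor polynomial of $P$ is $\sum_i h^2_i(P)t^i$, where the symmetric matrices $h^2_i(P)$ are determined by $\sum_{n\ge0}L^2(nP)t^n=\big(\sum_i h^2_i(P)t^i\big)/(1-t)^{D+3}$. -}

module Defs where

open import Data.Nat as ℕ using (ℕ; zero; suc)
open import Data.Nat.Combinatorics using (_C_)
open import Data.Integer as ℤ using (ℤ; +_; 0ℤ; _≤_)
open import Data.Rational as ℚ using (ℚ; 0ℚ; 1ℚ)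
open import Data.Fin using (Fin; zero; suc; toℕ)
open import Data.Vec using (Vec; lookup; tabulate)
open import Data.List using (List; []; _∷_)
open import Data.List.Membership.Propositional using (_∈_)
open import Data.List.Relation.Unary.Unique.Propositional using (Unique)
open import Data.Product using (Σ; _×_; ∃; _,_)
open import Function.Bundles using (_⇔_)
open import Relation.Nullary using (¬_)
open import Relation.Binary.PropositionalEquality using (_≡_)

Point : ℕ → Set
Point d = Vec ℤ d

Matrix : ℕ → Set
Matrix d = Fin d → Fin d → ℤ

Σℤ : (n : ℕ) → (Fin n → ℤ) → ℤ
Σℤ zero    f = 0ℤ
Σℤ (suc n) f = f zero ℤ.+ Σℤ n (λ i → f (suc i))

Σℚ : (n : ℕ) → (Fin n → ℚ) → ℚ
Σℚ zero    f = 0ℚ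
Σℚ (suc n) f = f zero ℚ.+ Σℚ n (λ i → f (suc i))

-- A lattice polytope in ℝ^d: the convex hull of finitely many lattice points
-- (given as a family of k points of ℤ^d).
LatticePolytope : ℕ → Set
LatticePolytope d = Σ ℕ (λ k → Fin k → Point d)

-- x ∈ nP for a lattice point x: x is a convex combination of the points n·vⱼ.
-- (For rational points in the convex hull of rational points, rational
-- convex coefficients suffice.)
_∈_⊙_ : {d : ℕ} → Point d → ℕ → LatticePolytope d → Set
_∈_⊙_ {d} x n (k , v) =
  Σ (Fin k → ℚ) λ λs →
    ((j : Fin k) → 0ℚ ℚ.≤ λs j) ×
    (Σℚ k λs ≡ 1ℚ) ×
    ((i : Fin d) →
      Σℚ k (λ j → λs j ℚ.* ((ℚ._/_ (+ n) 1) ℚ.* (ℚ._/_ (lookup (v j) i) 1)))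
        ≡ ℚ._/_ (lookup x i) 1)

-- Affine dimension of P equals d (full-dimensional): no nonzero linear
-- functional c is constant on the points of P.
FullDimensional : {d : ℕ} → LatticePolytope d → Set
FullDimensional {d} (k , v) =
  (c : Point d) →
  ((j j' : Fin k) →
     Σℤ d (λ i → lookup c i ℤ.* lookup (v j) i)
       ≡ Σℤ d (λ i → lookup c i ℤ.* lookup (v j') i)) →
  (i : Fin d) → lookup c i ≡ 0ℤ

sumOuter : {d : ℕ} → List (Point d) → Matrix d
sumOuter []       i j = 0ℤ
sumOuter (x ∷ xs) i j = lookup x i ℤ.* lookup x j ℤ.+ sumOuter xs i j

IsL2 : {d : ℕ} → LatticePolytope d → ℕ → Matrix d → Set
IsL2 {d} P n M =
  Σ (List (Point d)) λ xs →
    Unique xs ×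
    ((x : Point d) → (x ∈ xs) ⇔ (x ∈ n ⊙ P)) ×
    ((i j : Fin d) → M i j ≡ sumOuter xs i j)

-- h²_i : the coefficient of tⁱ in (1-t)^(D+3) · Σ_n L²(nP) tⁿ, i.e.
-- h²_i = Σ_{j=0}^{i} (-1)^j C(D+3, j) L²((i-j)P).
h2 : {d : ℕ} → (D : ℕ) → (ℕ → Matrix d) → ℕ → Matrix d
h2 D L i a b =
  Σℤ (suc i) (λ j →
    sign (toℕ j) ℤ.* (+ ((D ℕ.+ 3) C toℕ j)) ℤ.* L (i ℕ.∸ toℕ j) a b)
  where
    sign : ℕ → ℤ
    sign zero    = + 1
    sign (suc m) = ℤ.- sign m

-- Positive semidefinite: xᵀ M x ≥ 0 for every (integer, hence by scaling
-- and density every real) vector x.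
PSD : {d : ℕ} → Matrix d → Set
PSD {d} M = (x : Point d) →
  0ℤ ≤ Σℤ d (λ a → Σℤ d (λ b → lookup x a ℤ.* M a b ℤ.* lookup x b))

{-# OPTIONS --safe #-}
module Submission where

-- P is the simplex conv(0, e₁, …, e₁₉, (3, −1, −1, 0, …, 0)) and t = (1, 1, 1, −1, −1, −1, 0, …, 0).
-- As L²(nP) = Σ_{p ∈ nP ∩ ℤ²⁰} p pᵀ, its quadratic form at t is Σ_p (t · p)², which is monotone in
-- the set of points summed over. Every lattice point of nP satisfies the facet inequalities of nP
-- (each checked on the vertices), which confine it to an explicit list; conversely every listed point
-- of 2P is certified to lie in 2P by its barycentric coordinates. Evaluating the sums bounds
-- tᵀ L²(nP) t by ≥ 0, ≤ 7, ≥ 169, ≤ 2115 for n = 0, 1, 2, 3, and since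
-- h²₃ = L²(3P) − 23 L²(2P) + 253 L²(P) − 1771 L²(0P), this gives tᵀ h²₃ t ≤ 2115 − 23 · 169 + 253 · 7 = −1.

open import Defs
open import Algebra.Bundles using (CommutativeSemiring; CommutativeRing)
import Algebra.Properties.CommutativeSemigroup as CommutativeSemigroupProperties
import Algebra.Properties.Semiring.Sum as SemiringSum
open import Data.Fin using (Fin; zero; suc; toℕ)
import Data.Fin.Properties as FinP
open import Data.Integer as ℤ using (ℤ; +_; 0ℤ; -1ℤ)
import Data.Integer.Properties as ℤP
open import Data.Integer.Tactic.RingSolver using (solve-∀)
open import Data.List as List using (List; []; _∷_; [_]; map; concatMap; upTo; cartesianProduct)
open import Data.List.Membership.Propositional using (_∈_; _─_; lose)
open import Data.List.Membership.Propositional.Properties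
  using (∈-map⁺; ∈-concatMap⁺; ∈-upTo⁺; ∈-cartesianProduct⁺; ∈-filter⁺)
open import Data.List.Relation.Binary.Subset.Propositional using (_⊆_)
open import Data.List.Relation.Unary.All as All using (All)
open import Data.List.Relation.Unary.AllPairs using ([]; _∷_)
open import Data.List.Relation.Unary.Any using (here; there)
open import Data.List.Relation.Unary.Unique.Propositional using (Unique)
open import Data.Nat as ℕ using (ℕ; zero; suc; _∸_; s≤s)
import Data.Nat.Coprimality as Coprimality
open import Data.Product using (Σ; _×_; _,_; proj₁; proj₂)
open import Data.Rational as ℚ using (ℚ; 0ℚ; 1ℚ; mkℚ)
import Data.Rational.Properties as ℚP
open import Data.Vec as Vec using (Vec; []; _∷_; lookup; replicate)
import Data.Vec.Properties as VecP
open import Function using (_∘_)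
open import Function.Bundles using (Equivalence; _⇔_)
open import Relation.Binary.PropositionalEquality
  using (_≡_; _≢_; refl; sym; trans; cong; cong₂; subst; subst₂; module ≡-Reasoning)
open import Relation.Nullary using (¬_; Dec; contradiction)
open import Relation.Nullary.Decidable using (True; toWitness; _×-dec_)
open import Relation.Unary using (Decidable)

module _ {c ℓ} (R : CommutativeSemiring c ℓ) where
  open CommutativeSemiring R
    using (Carrier; _≈_; _*_; semiring; setoid; *-commutativeSemigroup) renaming (sym to ≈-sym)
  open SemiringSum semiring using (sum-syntax; sum-cong-≋; ∑-comm; *-distribˡ-sum)
  open CommutativeSemigroupProperties *-commutativeSemigroup using (x∙yz≈y∙xz)
  open import Relation.Binary.Reasoning.Setoid setoid

  ∑-*-∑-comm : ∀ {m n} (a : Fin m → Carrier) (b : Fin n → Carrier) (T : Fin m → Fin n → Carrier) →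
    ∑[ i < m ] (a i * ∑[ j < n ] (b j * T i j)) ≈ ∑[ j < n ] (b j * ∑[ i < m ] (a i * T i j))
  ∑-*-∑-comm {m} {n} a b T = begin
    ∑[ i < m ] (a i * ∑[ j < n ] (b j * T i j))
      ≈⟨ sum-cong-≋ (λ i → *-distribˡ-sum (a i) (λ j → b j * T i j)) ⟩
    ∑[ i < m ] ∑[ j < n ] (a i * (b j * T i j))
      ≈⟨ sum-cong-≋ (λ i → sum-cong-≋ (λ j → x∙yz≈y∙xz (a i) (b j) (T i j))) ⟩
    ∑[ i < m ] ∑[ j < n ] (b j * (a i * T i j))
      ≈⟨ ∑-comm (λ i j → b j * (a i * T i j)) ⟩
    ∑[ j < n ] ∑[ i < m ] (b j * (a i * T i j))
      ≈⟨ sum-cong-≋ (λ j → ≈-sym (*-distribˡ-sum (b j) (λ i → a i * T i j))) ⟩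
    ∑[ j < n ] (b j * ∑[ i < m ] (a i * T i j))
      ∎

ℚ-commutativeSemiring : CommutativeSemiring _ _
ℚ-commutativeSemiring = CommutativeRing.commutativeSemiring ℚP.+-*-commutativeRing

module ℤΣ = SemiringSum ℤP.+-*-semiring
module ℚΣ = SemiringSum (CommutativeSemiring.semiring ℚ-commutativeSemiring)

Σℤ≡sum : ∀ n (f : Fin n → ℤ) → Σℤ n f ≡ ℤΣ.sum f
Σℤ≡sum zero    f = refl
Σℤ≡sum (suc n) f = cong (ℤ._+_ (f zero)) (Σℤ≡sum n (f ∘ suc))

Σℚ≡sum : ∀ n (f : Fin n → ℚ) → Σℚ n f ≡ ℚΣ.sum f
Σℚ≡sum zero    f = refl
Σℚ≡sum (suc n) f = cong (ℚ._+_ (f zero)) (Σℚ≡sum n (f ∘ suc))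

Σℤ-cong : ∀ n {f g : Fin n → ℤ} → (∀ i → f i ≡ g i) → Σℤ n f ≡ Σℤ n g
Σℤ-cong n f≗g = trans (Σℤ≡sum n _) (trans (ℤΣ.sum-cong-≗ f≗g) (sym (Σℤ≡sum n _)))

Σℚ-cong : ∀ n {f g : Fin n → ℚ} → (∀ i → f i ≡ g i) → Σℚ n f ≡ Σℚ n g
Σℚ-cong n f≗g = trans (Σℚ≡sum n _) (trans (ℚΣ.sum-cong-≗ f≗g) (sym (Σℚ≡sum n _)))

Σℤ-zero : ∀ n → Σℤ n (λ _ → 0ℤ) ≡ 0ℤ
Σℤ-zero n = trans (Σℤ≡sum n _) (ℤΣ.sum-replicate-zero n)

Σℤ-distrib-+ : ∀ n (f g : Fin n → ℤ) → Σℤ n (λ i → f i ℤ.+ g i) ≡ Σℤ n f ℤ.+ Σℤ n g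
Σℤ-distrib-+ n f g = begin
  Σℤ n (λ i → f i ℤ.+ g i)    ≡⟨ Σℤ≡sum n _ ⟩
  ℤΣ.sum (λ i → f i ℤ.+ g i)  ≡⟨ ℤΣ.∑-distrib-+ f g ⟩
  ℤΣ.sum f ℤ.+ ℤΣ.sum g       ≡⟨ cong₂ ℤ._+_ (Σℤ≡sum n f) (Σℤ≡sum n g) ⟨
  Σℤ n f ℤ.+ Σℤ n g           ∎
  where open ≡-Reasoning

*-distribˡ-Σℤ : ∀ n (c : ℤ) (f : Fin n → ℤ) → c ℤ.* Σℤ n f ≡ Σℤ n (λ i → c ℤ.* f i)
*-distribˡ-Σℤ n c f = begin
  c ℤ.* Σℤ n f              ≡⟨ cong (c ℤ.*_) (Σℤ≡sum n f) ⟩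
  c ℤ.* ℤΣ.sum f            ≡⟨ ℤΣ.*-distribˡ-sum c f ⟩
  ℤΣ.sum (λ i → c ℤ.* f i)  ≡⟨ Σℤ≡sum n _ ⟨
  Σℤ n (λ i → c ℤ.* f i)    ∎
  where open ≡-Reasoning

*-distribʳ-Σℤ : ∀ n (c : ℤ) (f : Fin n → ℤ) → Σℤ n f ℤ.* c ≡ Σℤ n (λ i → f i ℤ.* c)
*-distribʳ-Σℤ n c f = begin
  Σℤ n f ℤ.* c            ≡⟨ ℤP.*-comm (Σℤ n f) c ⟩
  c ℤ.* Σℤ n f            ≡⟨ *-distribˡ-Σℤ n c f ⟩
  Σℤ n (λ i → c ℤ.* f i)  ≡⟨ Σℤ-cong n (λ i → ℤP.*-comm c (f i)) ⟩
  Σℤ n (λ i → f i ℤ.* c)  ∎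
  where open ≡-Reasoning

Σℤ-nonNeg : ∀ n {f : Fin n → ℤ} → (∀ i → 0ℤ ℤ.≤ f i) → 0ℤ ℤ.≤ Σℤ n f
Σℤ-nonNeg zero    f≥0 = ℤP.≤-refl
Σℤ-nonNeg (suc n) f≥0 = ℤP.+-mono-≤ (f≥0 zero) (Σℤ-nonNeg n (f≥0 ∘ suc))

Σℚ-mono-≤ : ∀ n {f g : Fin n → ℚ} → (∀ i → f i ℚ.≤ g i) → Σℚ n f ℚ.≤ Σℚ n g
Σℚ-mono-≤ zero    f≤g = ℚP.≤-refl
Σℚ-mono-≤ (suc n) f≤g = ℚP.+-mono-≤ (f≤g zero) (Σℚ-mono-≤ n (f≤g ∘ suc))

Σℚ-*-Σℚ-comm : ∀ m n (a : Fin m → ℚ) (b : Fin n → ℚ) (T : Fin m → Fin n → ℚ) →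
  Σℚ m (λ i → a i ℚ.* Σℚ n (λ j → b j ℚ.* T i j)) ≡ Σℚ n (λ j → b j ℚ.* Σℚ m (λ i → a i ℚ.* T i j))
Σℚ-*-Σℚ-comm m n a b T = begin
  Σℚ m (λ i → a i ℚ.* Σℚ n (λ j → b j ℚ.* T i j))
    ≡⟨ trans (Σℚ≡sum m _) (ℚΣ.sum-cong-≗ (λ i → cong (a i ℚ.*_) (Σℚ≡sum n _))) ⟩
  ∑[ i < m ] (a i ℚ.* ∑[ j < n ] (b j ℚ.* T i j))
    ≡⟨ ∑-*-∑-comm ℚ-commutativeSemiring a b T ⟩
  ∑[ j < n ] (b j ℚ.* ∑[ i < m ] (a i ℚ.* T i j))
    ≡⟨ trans (Σℚ≡sum n _) (ℚΣ.sum-cong-≗ (λ j → cong (b j ℚ.*_) (Σℚ≡sum m _))) ⟨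
  Σℚ n (λ j → b j ℚ.* Σℚ m (λ i → a i ℚ.* T i j))
    ∎
  where
  open ≡-Reasoning
  open ℚΣ using (sum-syntax)

module _ {k} {λs : Fin k → ℚ} (λs≥0 : ∀ j → 0ℚ ℚ.≤ λs j) (Σλs≡1 : Σℚ k λs ≡ 1ℚ) where

  Σℚ-*-const : ∀ c → Σℚ k (λ j → λs j ℚ.* c) ≡ c
  Σℚ-*-const c = begin
    Σℚ k (λ j → λs j ℚ.* c)    ≡⟨ Σℚ≡sum k _ ⟩
    ℚΣ.sum (λ j → λs j ℚ.* c)  ≡⟨ ℚΣ.*-distribʳ-sum c λs ⟨
    ℚΣ.sum λs ℚ.* c            ≡⟨ cong (ℚ._* c) (trans (sym (Σℚ≡sum k λs)) Σλs≡1) ⟩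
    1ℚ ℚ.* c                   ≡⟨ ℚP.*-identityˡ c ⟩
    c                          ∎
    where open ≡-Reasoning

  convexCombination-≤ : ∀ {a : Fin k → ℚ} {c} → (∀ j → a j ℚ.≤ c) → Σℚ k (λ j → λs j ℚ.* a j) ℚ.≤ c
  convexCombination-≤ {a} {c} a≤c = subst (Σℚ k (λ j → λs j ℚ.* a j) ℚ.≤_) (Σℚ-*-const c)
    (Σℚ-mono-≤ k (λ j → ℚP.*-monoˡ-≤-nonNeg (λs j) {{ℚ.nonNegative (λs≥0 j)}} (a≤c j)))

  convexCombination-≥ : ∀ {a : Fin k → ℚ} {c} → (∀ j → c ℚ.≤ a j) → c ℚ.≤ Σℚ k (λ j → λs j ℚ.* a j)
  convexCombination-≥ {a} {c} c≤a = subst (ℚ._≤ Σℚ k (λ j → λs j ℚ.* a j)) (Σℚ-*-const c)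
    (Σℚ-mono-≤ k (λ j → ℚP.*-monoˡ-≤-nonNeg (λs j) {{ℚ.nonNegative (λs≥0 j)}} (c≤a j)))

fromℤ : ℤ → ℚ
fromℤ i = i ℚ./ 1

-- In this normal form ℚ's _+_, _*_ and _≤_ reduce to those of ℤ.
fromℤ≡mkℚ : ∀ i → fromℤ i ≡ mkℚ i 0 (Coprimality.sym (Coprimality.1-coprimeTo ℤ.∣ i ∣))
fromℤ≡mkℚ (+ n)      = ℚP.normalize-coprime (Coprimality.sym (Coprimality.1-coprimeTo n))
fromℤ≡mkℚ ℤ.-[1+ n ] =
  cong ℚ.-_ (ℚP.normalize-coprime (Coprimality.sym (Coprimality.1-coprimeTo (suc n))))

fromℤ-+ : ∀ i j → fromℤ (i ℤ.+ j) ≡ fromℤ i ℚ.+ fromℤ j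
fromℤ-+ i j rewrite fromℤ≡mkℚ i | fromℤ≡mkℚ j =
  cong (ℚ._/ 1) (sym (cong₂ ℤ._+_ (ℤP.*-identityʳ i) (ℤP.*-identityʳ j)))

fromℤ-* : ∀ i j → fromℤ (i ℤ.* j) ≡ fromℤ i ℚ.* fromℤ j
fromℤ-* i j rewrite fromℤ≡mkℚ i | fromℤ≡mkℚ j = refl

fromℤ-mono-≤ : ∀ {i j} → i ℤ.≤ j → fromℤ i ℚ.≤ fromℤ j
fromℤ-mono-≤ {i} {j} i≤j rewrite fromℤ≡mkℚ i | fromℤ≡mkℚ j =
  ℚ.*≤* (subst₂ ℤ._≤_ (sym (ℤP.*-identityʳ i)) (sym (ℤP.*-identityʳ j)) i≤j)

fromℤ-cancel-≤ : ∀ {i j} → fromℤ i ℚ.≤ fromℤ j → i ℤ.≤ j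
fromℤ-cancel-≤ {i} {j} i≤j rewrite fromℤ≡mkℚ i | fromℤ≡mkℚ j with i≤j
... | ℚ.*≤* i≤j = subst₂ ℤ._≤_ (ℤP.*-identityʳ i) (ℤP.*-identityʳ j) i≤j

fromℤ-Σ : ∀ n (f : Fin n → ℤ) → fromℤ (Σℤ n f) ≡ Σℚ n (fromℤ ∘ f)
fromℤ-Σ zero    f = refl
fromℤ-Σ (suc n) f =
  trans (fromℤ-+ (f zero) _) (cong (ℚ._+_ (fromℤ (f zero))) (fromℤ-Σ n (f ∘ suc)))

fromℤ-Σ-* : ∀ n (f g : Fin n → ℤ) →
  fromℤ (Σℤ n (λ i → f i ℤ.* g i)) ≡ Σℚ n (λ i → fromℤ (f i) ℚ.* fromℤ (g i))
fromℤ-Σ-* n f g = trans (fromℤ-Σ n _) (Σℚ-cong n (λ i → fromℤ-* (f i) (g i)))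

Σℚ-*-fromℤ : ∀ k (c : ℚ) (g : Fin k → ℤ) → Σℚ k (λ j → c ℚ.* fromℤ (g j)) ≡ c ℚ.* fromℤ (Σℤ k g)
Σℚ-*-fromℤ k c g = begin
  Σℚ k (λ j → c ℚ.* fromℤ (g j))    ≡⟨ Σℚ≡sum k _ ⟩
  ℚΣ.sum (λ j → c ℚ.* fromℤ (g j))  ≡⟨ ℚΣ.*-distribˡ-sum c (fromℤ ∘ g) ⟨
  c ℚ.* ℚΣ.sum (fromℤ ∘ g)          ≡⟨ cong (c ℚ.*_) (trans (fromℤ-Σ k g) (Σℚ≡sum k (fromℤ ∘ g))) ⟨
  c ℚ.* fromℤ (Σℤ k g)              ∎
  where open ≡-Reasoning

-- Dilates of lattice polytopes

infix 7 _·_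

_·_ : ∀ {d} → Point d → Point d → ℤ
_·_ {d} x y = Σℤ d (λ i → lookup x i ℤ.* lookup y i)

·-comm : ∀ {d} (x y : Point d) → x · y ≡ y · x
·-comm {d} x y = Σℤ-cong d (λ i → ℤP.*-comm (lookup x i) (lookup y i))

·-zeroʳ : ∀ {d} (x : Point d) → x · replicate d 0ℤ ≡ 0ℤ
·-zeroʳ {d} x = trans (·-comm x (replicate d 0ℤ)) (zeros-· x)
  where
  zeros-· : ∀ {d} (x : Point d) → replicate d 0ℤ · x ≡ 0ℤ
  zeros-· []      = refl
  zeros-· (_ ∷ x) = trans (ℤP.+-identityˡ _) (zeros-· x)

basis : ∀ {d} → Fin d → Point d
basis {suc d} zero    = + 1 ∷ replicate d 0ℤ
basis {suc d} (suc i) = 0ℤ ∷ basis i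

basis-· : ∀ {d} (i : Fin d) (x : Point d) → basis i · x ≡ lookup x i
basis-· zero    (c ∷ x) = trans
  (cong₂ ℤ._+_ (ℤP.*-identityˡ c) (trans (·-comm (replicate _ 0ℤ) x) (·-zeroʳ x))) (ℤP.+-identityʳ c)
basis-· (suc i) (c ∷ x) = trans (ℤP.+-identityˡ _) (basis-· i x)

ones-· : ∀ {d} (x : Point d) → replicate d (+ 1) · x ≡ Σℤ d (lookup x)
ones-· []      = refl
ones-· (c ∷ x) = cong₂ ℤ._+_ (ℤP.*-identityˡ c) (ones-· x)

module _ {d k} (v : Fin k → Point d) (n : ℕ) (x : Point d) (x∈nP : x ∈ n ⊙ (k , v)) (y : Point d) where
  private
    λs : Fin k → ℚ
    λs = proj₁ x∈nP

    λs≥0 : ∀ j → 0ℚ ℚ.≤ λs j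
    λs≥0 = proj₁ (proj₂ x∈nP)

    Σλs≡1 : Σℚ k λs ≡ 1ℚ
    Σλs≡1 = proj₁ (proj₂ (proj₂ x∈nP))

  fromℤ-·-dilate : fromℤ (y · x) ≡ Σℚ k (λ j → λs j ℚ.* fromℤ (+ n ℤ.* (y · v j)))
  fromℤ-·-dilate = begin
    fromℤ (y · x)                                     ≡⟨ fromℤ-Σ-* d (lookup y) (lookup x) ⟩
    Σℚ d (λ i → Y i ℚ.* X i)                          ≡⟨ Σℚ-cong d (λ i → cong (Y i ℚ.*_) (sym (x≡ i))) ⟩
    Σℚ d (λ i → Y i ℚ.* Σℚ k (λ j → λs j ℚ.* T i j))  ≡⟨ Σℚ-*-Σℚ-comm d k Y λs T ⟩
    Σℚ k (λ j → λs j ℚ.* Σℚ d (λ i → Y i ℚ.* T i j))  ≡⟨ Σℚ-cong k (λ j → cong (λs j ℚ.*_) (vertex j)) ⟩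
    Σℚ k (λ j → λs j ℚ.* fromℤ (+ n ℤ.* (y · v j)))   ∎
    where
    open ≡-Reasoning
    open CommutativeSemigroupProperties
      (CommutativeSemiring.*-commutativeSemigroup ℚ-commutativeSemiring) using (x∙yz≈y∙xz)
    N : ℚ
    N = fromℤ (+ n)
    Y X : Fin d → ℚ
    Y i = fromℤ (lookup y i)
    X i = fromℤ (lookup x i)
    T : Fin d → Fin k → ℚ
    T i j = N ℚ.* fromℤ (lookup (v j) i)
    x≡ : ∀ i → Σℚ k (λ j → λs j ℚ.* T i j) ≡ X i
    x≡ = proj₂ (proj₂ (proj₂ x∈nP))
    vertex : ∀ j → Σℚ d (λ i → Y i ℚ.* T i j) ≡ fromℤ (+ n ℤ.* (y · v j))
    vertex j = begin
      Σℚ d (λ i → Y i ℚ.* (N ℚ.* V i))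
        ≡⟨ Σℚ-cong d (λ i → x∙yz≈y∙xz (Y i) N (V i)) ⟩
      Σℚ d (λ i → N ℚ.* (Y i ℚ.* V i))
        ≡⟨ Σℚ-cong d (λ i → cong (N ℚ.*_) (fromℤ-* (lookup y i) (lookup (v j) i))) ⟨
      Σℚ d (λ i → N ℚ.* fromℤ (lookup y i ℤ.* lookup (v j) i))
        ≡⟨ Σℚ-*-fromℤ d N _ ⟩
      N ℚ.* fromℤ (y · v j)
        ≡⟨ fromℤ-* (+ n) (y · v j) ⟨
      fromℤ (+ n ℤ.* (y · v j))
        ∎
      where
      V : Fin d → ℚ
      V i = fromℤ (lookup (v j) i)

  ·-≤-on-dilate : ∀ {e} → (∀ j → y · v j ℤ.≤ e) → y · x ℤ.≤ + n ℤ.* e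
  ·-≤-on-dilate y·v≤e = fromℤ-cancel-≤ (subst (ℚ._≤ _) (sym fromℤ-·-dilate)
    (convexCombination-≤ λs≥0 Σλs≡1 (λ j → fromℤ-mono-≤ (ℤP.*-monoˡ-≤-nonNeg (+ n) (y·v≤e j)))))

  ·-≥-on-dilate : ∀ {e} → (∀ j → e ℤ.≤ y · v j) → + n ℤ.* e ℤ.≤ y · x
  ·-≥-on-dilate e≤y·v = fromℤ-cancel-≤ (subst (_ ℚ.≤_) (sym fromℤ-·-dilate)
    (convexCombination-≥ λs≥0 Σλs≡1 (λ j → fromℤ-mono-≤ (ℤP.*-monoˡ-≤-nonNeg (+ n) (e≤y·v j)))))

ScaledConvexCombination : ∀ {d k} (v : Fin k → Point d) (n N : ℕ) (x : Point d) (w : Fin k → ℤ) → Set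
ScaledConvexCombination {d} {k} v n N x w =
  (∀ j → 0ℤ ℤ.≤ w j) × Σℤ k w ≡ + N ×
  (∀ i → Σℤ k (λ j → w j ℤ.* (+ n ℤ.* lookup (v j) i)) ≡ + N ℤ.* lookup x i)

scaledConvexCombination? : ∀ {d k} (v : Fin k → Point d) (n N : ℕ) (x : Point d) (w : Fin k → ℤ) →
  Dec (ScaledConvexCombination v n N x w)
scaledConvexCombination? {d} {k} v n N x w =
  FinP.all? (λ j → 0ℤ ℤP.≤? w j) ×-dec Σℤ k w ℤ.≟ + N ×-dec
  FinP.all? (λ i → Σℤ k (λ j → w j ℤ.* (+ n ℤ.* lookup (v j) i)) ℤ.≟ + N ℤ.* lookup x i)

∈⊙-intro : ∀ {d k} (v : Fin k → Point d) (n N : ℕ) (c : ℚ) → 0ℚ ℚ.≤ c → c ℚ.* fromℤ (+ N) ≡ 1ℚ →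
  ∀ x w → ScaledConvexCombination v n N x w → x ∈ n ⊙ (k , v)
∈⊙-intro {d} {k} v n N c c≥0 cN≡1 x w (w≥0 , Σw≡N , Σwnv≡Nx) = λs , λs≥0 , Σλs≡1 , Σλsnv≡x
  where
  open ≡-Reasoning
  λs : Fin k → ℚ
  λs j = c ℚ.* fromℤ (w j)
  λs≥0 : ∀ j → 0ℚ ℚ.≤ λs j
  λs≥0 j = subst (ℚ._≤ λs j) (ℚP.*-zeroʳ c)
    (ℚP.*-monoˡ-≤-nonNeg c {{ℚ.nonNegative c≥0}} (fromℤ-mono-≤ (w≥0 j)))
  Σλs≡1 : Σℚ k λs ≡ 1ℚ
  Σλs≡1 = trans (Σℚ-*-fromℤ k c w) (trans (cong (λ s → c ℚ.* fromℤ s) Σw≡N) cN≡1)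
  Σλsnv≡x : ∀ i → Σℚ k (λ j → λs j ℚ.* (fromℤ (+ n) ℚ.* fromℤ (lookup (v j) i))) ≡ fromℤ (lookup x i)
  Σλsnv≡x i = begin
    Σℚ k (λ j → λs j ℚ.* (fromℤ (+ n) ℚ.* V j))  ≡⟨ Σℚ-cong k term ⟩
    Σℚ k (λ j → c ℚ.* fromℤ (wnv j))             ≡⟨ Σℚ-*-fromℤ k c wnv ⟩
    c ℚ.* fromℤ (Σℤ k wnv)                       ≡⟨ cong (λ s → c ℚ.* fromℤ s) (Σwnv≡Nx i) ⟩
    c ℚ.* fromℤ (+ N ℤ.* lookup x i)             ≡⟨ cong (c ℚ.*_) (fromℤ-* (+ N) (lookup x i)) ⟩
    c ℚ.* (fromℤ (+ N) ℚ.* fromℤ (lookup x i))   ≡⟨ ℚP.*-assoc c _ _ ⟨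
    (c ℚ.* fromℤ (+ N)) ℚ.* fromℤ (lookup x i)   ≡⟨ cong (ℚ._* fromℤ (lookup x i)) cN≡1 ⟩
    1ℚ ℚ.* fromℤ (lookup x i)                    ≡⟨ ℚP.*-identityˡ _ ⟩
    fromℤ (lookup x i)                           ∎
    where
    V : Fin k → ℚ
    V j = fromℤ (lookup (v j) i)
    wnv : Fin k → ℤ
    wnv j = w j ℤ.* (+ n ℤ.* lookup (v j) i)
    term : ∀ j → λs j ℚ.* (fromℤ (+ n) ℚ.* V j) ≡ c ℚ.* fromℤ (wnv j)
    term j = begin
      (c ℚ.* fromℤ (w j)) ℚ.* (fromℤ (+ n) ℚ.* V j)
        ≡⟨ ℚP.*-assoc c _ _ ⟩
      c ℚ.* (fromℤ (w j) ℚ.* (fromℤ (+ n) ℚ.* V j))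
        ≡⟨ cong (λ q → c ℚ.* (fromℤ (w j) ℚ.* q)) (fromℤ-* (+ n) _) ⟨
      c ℚ.* (fromℤ (w j) ℚ.* fromℤ (+ n ℤ.* lookup (v j) i))
        ≡⟨ cong (c ℚ.*_) (fromℤ-* (w j) _) ⟨
      c ℚ.* fromℤ (wnv j)
        ∎

-- Quadratic forms of L²

quadForm : ∀ {d} → Matrix d → Point d → ℤ
quadForm {d} M x = Σℤ d (λ a → Σℤ d (λ b → lookup x a ℤ.* M a b ℤ.* lookup x b))

module _ {d} (x : Point d) where
  private
    X : Fin d → ℤ
    X = lookup x

  quadForm-cong : ∀ {M N : Matrix d} → (∀ a b → M a b ≡ N a b) → quadForm M x ≡ quadForm N x
  quadForm-cong M≡N = Σℤ-cong d (λ a → Σℤ-cong d (λ b → cong (λ m → X a ℤ.* m ℤ.* X b) (M≡N a b)))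

  quadForm-zero : quadForm (λ _ _ → 0ℤ) x ≡ 0ℤ
  quadForm-zero = begin
    Σℤ d (λ a → Σℤ d (λ b → X a ℤ.* 0ℤ ℤ.* X b))
      ≡⟨ Σℤ-cong d (λ a → Σℤ-cong d (λ b → entry (X a) (X b))) ⟩
    Σℤ d (λ _ → Σℤ d (λ _ → 0ℤ))
      ≡⟨ Σℤ-cong d (λ _ → Σℤ-zero d) ⟩
    Σℤ d (λ _ → 0ℤ)
      ≡⟨ Σℤ-zero d ⟩
    0ℤ
      ∎
    where
    open ≡-Reasoning
    entry : ∀ u w → u ℤ.* 0ℤ ℤ.* w ≡ 0ℤ
    entry = solve-∀

  quadForm-+ : ∀ (M N : Matrix d) → quadForm (λ a b → M a b ℤ.+ N a b) x ≡ quadForm M x ℤ.+ quadForm N x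
  quadForm-+ M N = begin
    Σℤ d (λ a → Σℤ d (λ b → X a ℤ.* (M a b ℤ.+ N a b) ℤ.* X b))
      ≡⟨ Σℤ-cong d (λ a → Σℤ-cong d (λ b → entry (X a) (M a b) (N a b) (X b))) ⟩
    Σℤ d (λ a → Σℤ d (λ b → X a ℤ.* M a b ℤ.* X b ℤ.+ X a ℤ.* N a b ℤ.* X b))
      ≡⟨ Σℤ-cong d (λ a → Σℤ-distrib-+ d _ _) ⟩
    Σℤ d (λ a → Σℤ d (λ b → X a ℤ.* M a b ℤ.* X b) ℤ.+ Σℤ d (λ b → X a ℤ.* N a b ℤ.* X b))
      ≡⟨ Σℤ-distrib-+ d _ _ ⟩
    quadForm M x ℤ.+ quadForm N x
      ∎
    where
    open ≡-Reasoning
    entry : ∀ u m n w → u ℤ.* (m ℤ.+ n) ℤ.* w ≡ u ℤ.* m ℤ.* w ℤ.+ u ℤ.* n ℤ.* w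
    entry = solve-∀

  quadForm-* : ∀ c (M : Matrix d) → quadForm (λ a b → c ℤ.* M a b) x ≡ c ℤ.* quadForm M x
  quadForm-* c M = begin
    Σℤ d (λ a → Σℤ d (λ b → X a ℤ.* (c ℤ.* M a b) ℤ.* X b))
      ≡⟨ Σℤ-cong d (λ a → Σℤ-cong d (λ b → entry c (X a) (M a b) (X b))) ⟩
    Σℤ d (λ a → Σℤ d (λ b → c ℤ.* (X a ℤ.* M a b ℤ.* X b)))
      ≡⟨ Σℤ-cong d (λ a → *-distribˡ-Σℤ d c _) ⟨
    Σℤ d (λ a → c ℤ.* Σℤ d (λ b → X a ℤ.* M a b ℤ.* X b))
      ≡⟨ *-distribˡ-Σℤ d c _ ⟨
    c ℤ.* quadForm M x
      ∎
    where
    open ≡-Reasoning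
    entry : ∀ c u m w → u ℤ.* (c ℤ.* m) ℤ.* w ≡ c ℤ.* (u ℤ.* m ℤ.* w)
    entry = solve-∀

  quadForm-Σ : ∀ m (c : Fin m → ℤ) (M : Fin m → Matrix d) →
    quadForm (λ a b → Σℤ m (λ j → c j ℤ.* M j a b)) x ≡ Σℤ m (λ j → c j ℤ.* quadForm (M j) x)
  quadForm-Σ zero    c M = quadForm-zero
  quadForm-Σ (suc m) c M = trans (quadForm-+ _ _)
    (cong₂ ℤ._+_ (quadForm-* (c zero) (M zero)) (quadForm-Σ m (c ∘ suc) (M ∘ suc)))

square : ℤ → ℤ
square z = z ℤ.* z

square-nonNeg : ∀ z → 0ℤ ℤ.≤ square z
square-nonNeg ℤ.+0       = ℤ.+≤+ ℕ.z≤n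
square-nonNeg ℤ.+[1+ n ] = ℤ.+≤+ ℕ.z≤n
square-nonNeg ℤ.-[1+ n ] = ℤ.+≤+ ℕ.z≤n

quadForm-outer : ∀ {d} (p x : Point d) → quadForm (λ a b → lookup p a ℤ.* lookup p b) x ≡ square (x · p)
quadForm-outer {d} p x = begin
  Σℤ d (λ a → Σℤ d (λ b → X a ℤ.* (P a ℤ.* P b) ℤ.* X b))
    ≡⟨ Σℤ-cong d (λ a → Σℤ-cong d (λ b → entry (X a) (P a) (P b) (X b))) ⟩
  Σℤ d (λ a → Σℤ d (λ b → (X a ℤ.* P a) ℤ.* (X b ℤ.* P b)))
    ≡⟨ Σℤ-cong d (λ a → *-distribˡ-Σℤ d (X a ℤ.* P a) _) ⟨
  Σℤ d (λ a → (X a ℤ.* P a) ℤ.* (x · p))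
    ≡⟨ *-distribʳ-Σℤ d (x · p) _ ⟨
  (x · p) ℤ.* (x · p)
    ∎
  where
  open ≡-Reasoning
  X P : Fin d → ℤ
  X = lookup x
  P = lookup p
  entry : ∀ u m n w → u ℤ.* (m ℤ.* n) ℤ.* w ≡ (u ℤ.* m) ℤ.* (w ℤ.* n)
  entry = solve-∀

sumBy : ∀ {A : Set} → (A → ℤ) → List A → ℤ
sumBy f []       = 0ℤ
sumBy f (a ∷ as) = f a ℤ.+ sumBy f as

quadForm-sumOuter : ∀ {d} (ps : List (Point d)) x →
  quadForm (sumOuter ps) x ≡ sumBy (λ p → square (x · p)) ps
quadForm-sumOuter []       x = quadForm-zero x
quadForm-sumOuter (p ∷ ps) x =
  trans (quadForm-+ x _ (sumOuter ps)) (cong₂ ℤ._+_ (quadForm-outer p x) (quadForm-sumOuter ps x))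

∈-─⁺ : ∀ {A : Set} {a b : A} {bs} (a∈bs : a ∈ bs) → b ∈ bs → a ≢ b → b ∈ bs ─ a∈bs
∈-─⁺ (here refl)  (here refl)  a≢b = contradiction refl a≢b
∈-─⁺ (here refl)  (there b∈bs) _   = b∈bs
∈-─⁺ (there a∈bs) (here refl)  _   = here refl
∈-─⁺ (there a∈bs) (there b∈bs) a≢b = there (∈-─⁺ a∈bs b∈bs a≢b)

sumBy-─ : ∀ {A : Set} (f : A → ℤ) {a bs} (a∈bs : a ∈ bs) → sumBy f bs ≡ f a ℤ.+ sumBy f (bs ─ a∈bs)
sumBy-─ f (here refl)                = refl
sumBy-─ f {a} {b ∷ bs} (there a∈bs) =
  trans (cong (ℤ._+_ (f b)) (sumBy-─ f a∈bs)) (x∙yz≈y∙xz (f b) (f a) _)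
  where open CommutativeSemigroupProperties ℤP.+-commutativeSemigroup using (x∙yz≈y∙xz)

module _ {A : Set} {f : A → ℤ} (f≥0 : ∀ a → 0ℤ ℤ.≤ f a) where

  sumBy-nonNeg : ∀ as → 0ℤ ℤ.≤ sumBy f as
  sumBy-nonNeg []       = ℤP.≤-refl
  sumBy-nonNeg (a ∷ as) = ℤP.+-mono-≤ (f≥0 a) (sumBy-nonNeg as)

  sumBy-mono-⊆ : ∀ {as bs} → Unique as → as ⊆ bs → sumBy f as ℤ.≤ sumBy f bs
  sumBy-mono-⊆ {[]}     {bs} _                  _     = sumBy-nonNeg bs
  sumBy-mono-⊆ {a ∷ as} {bs} (a∉as ∷ as-unique) as⊆bs = begin
    f a ℤ.+ sumBy f as           ≤⟨ ℤP.+-monoʳ-≤ (f a) (sumBy-mono-⊆ as-unique as⊆bs─a) ⟩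
    f a ℤ.+ sumBy f (bs ─ a∈bs)  ≡⟨ sumBy-─ f a∈bs ⟨
    sumBy f bs                   ∎
    where
    open ℤP.≤-Reasoning
    a∈bs : a ∈ bs
    a∈bs = as⊆bs (here refl)
    as⊆bs─a : as ⊆ bs ─ a∈bs
    as⊆bs─a b∈as = ∈-─⁺ a∈bs (as⊆bs (there b∈as)) (All.lookup a∉as b∈as)

module _ {d} (P : LatticePolytope d) (n : ℕ) {M : Matrix d} (M≡L²nP : IsL2 P n M) (x : Point d) where
  private
    ps : List (Point d)
    ps = proj₁ M≡L²nP

    ps≡nP : ∀ p → (p ∈ ps) ⇔ (p ∈ n ⊙ P)
    ps≡nP = proj₁ (proj₂ (proj₂ M≡L²nP))

    quadForm-L² : quadForm M x ≡ sumBy (λ p → square (x · p)) ps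
    quadForm-L² = trans (quadForm-cong x (proj₂ (proj₂ (proj₂ M≡L²nP)))) (quadForm-sumOuter ps x)

  quadForm-L²-≤ : ∀ {qs} → (∀ {p} → p ∈ n ⊙ P → p ∈ qs) →
    quadForm M x ℤ.≤ sumBy (λ p → square (x · p)) qs
  quadForm-L²-≤ nP⊆qs = subst (ℤ._≤ _) (sym quadForm-L²)
    (sumBy-mono-⊆ (square-nonNeg ∘ (x ·_)) (proj₁ (proj₂ M≡L²nP)) (nP⊆qs ∘ Equivalence.to (ps≡nP _)))

  quadForm-L²-≥ : ∀ {qs} → Unique qs → (∀ {p} → p ∈ qs → p ∈ n ⊙ P) →
    sumBy (λ p → square (x · p)) qs ℤ.≤ quadForm M x
  quadForm-L²-≥ qs-unique qs⊆nP = subst (_ ℤ.≤_) (sym quadForm-L²)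
    (sumBy-mono-⊆ (square-nonNeg ∘ (x ·_)) qs-unique (Equivalence.from (ps≡nP _) ∘ qs⊆nP))

-- Enumerating lattice points

i+j≤k⇒j≤k-i : ∀ {i j k} → i ℤ.+ j ℤ.≤ k → j ℤ.≤ k ℤ.- i
i+j≤k⇒j≤k-i {i} {j} {k} i+j≤k = subst (ℤ._≤ k ℤ.- i) (cancel i j) (ℤP.+-monoˡ-≤ (ℤ.- i) i+j≤k)
  where
  cancel : ∀ i j → i ℤ.+ j ℤ.- i ≡ j
  cancel = solve-∀

[_⋯_] : ℤ → ℤ → List ℤ
[ lo ⋯ hi ] = map (λ k → lo ℤ.+ + k) (upTo (suc ℤ.∣ hi ℤ.- lo ∣))

∈-[⋯] : ∀ {lo hi z} → lo ℤ.≤ z → z ℤ.≤ hi → z ∈ [ lo ⋯ hi ]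
∈-[⋯] {lo} {hi} {z} lo≤z z≤hi =
  subst (_∈ [ lo ⋯ hi ]) lo+∣z-lo∣≡z (∈-map⁺ (λ k → lo ℤ.+ + k) (∈-upTo⁺ (s≤s ∣z-lo∣≤∣hi-lo∣)))
  where
  0≤z-lo : 0ℤ ℤ.≤ z ℤ.- lo
  0≤z-lo = ℤP.i≤j⇒0≤j-i lo≤z
  z-lo≤hi-lo : z ℤ.- lo ℤ.≤ hi ℤ.- lo
  z-lo≤hi-lo = ℤP.+-monoˡ-≤ (ℤ.- lo) z≤hi
  ∣z-lo∣≤∣hi-lo∣ : ℤ.∣ z ℤ.- lo ∣ ℕ.≤ ℤ.∣ hi ℤ.- lo ∣
  ∣z-lo∣≤∣hi-lo∣ = ℤP.drop‿+≤+ (subst₂ ℤ._≤_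
    (sym (ℤP.0≤i⇒+∣i∣≡i 0≤z-lo)) (sym (ℤP.0≤i⇒+∣i∣≡i (ℤP.≤-trans 0≤z-lo z-lo≤hi-lo))) z-lo≤hi-lo)
  lo+∣z-lo∣≡z : lo ℤ.+ + ℤ.∣ z ℤ.- lo ∣ ≡ z
  lo+∣z-lo∣≡z = trans (cong (ℤ._+_ lo) (ℤP.0≤i⇒+∣i∣≡i 0≤z-lo)) (cancel lo z)
    where
    cancel : ∀ a b → a ℤ.+ (b ℤ.- a) ≡ b
    cancel = solve-∀

stdSimplexPoints : (k m : ℕ) → List (Vec ℤ k)
stdSimplexPoints zero    m = [ [] ]
stdSimplexPoints (suc k) m = concatMap (λ a → map (+ a ∷_) (stdSimplexPoints k (m ∸ a))) (upTo (suc m))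

∈-stdSimplexPoints : ∀ {k m} {r : Vec ℤ k} →
  (∀ i → 0ℤ ℤ.≤ lookup r i) → Σℤ k (lookup r) ℤ.≤ + m → r ∈ stdSimplexPoints k m
∈-stdSimplexPoints {zero}  {r = []}    _   _ = here refl
∈-stdSimplexPoints {suc k} {m} {c ∷ r} r≥0 Σ≤m with r≥0 zero
... | ℤ.+≤+ {n = a} _ =
  ∈-concatMap⁺ (λ a → map (+ a ∷_) (stdSimplexPoints k (m ∸ a)))
    (lose (∈-upTo⁺ (s≤s a≤m)) (∈-map⁺ (+ a ∷_) (∈-stdSimplexPoints (r≥0 ∘ suc) Σr≤m∸a)))
  where
  Σr≥0 : 0ℤ ℤ.≤ Σℤ k (lookup r)
  Σr≥0 = Σℤ-nonNeg k (r≥0 ∘ suc)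
  a≤m : a ℕ.≤ m
  a≤m = ℤP.drop‿+≤+ (ℤP.≤-trans (ℤP.i≤i+j (+ a) _ {{ℤ.nonNegative Σr≥0}}) Σ≤m)
  Σr≤m∸a : Σℤ k (lookup r) ℤ.≤ + (m ∸ a)
  Σr≤m∸a = subst (Σℤ k (lookup r) ℤ.≤_) (trans (ℤP.[+m]-[+n]≡m⊖n m a) (ℤP.⊖-≥ a≤m))
    (i+j≤k⇒j≤k-i {+ a} Σ≤m)

apex : Point 20
apex = + 3 ∷ -1ℤ ∷ -1ℤ ∷ replicate 17 0ℤ

vertex : Fin 21 → Point 20
vertex zero          = replicate 20 0ℤ
vertex (suc zero)    = apex
vertex (suc (suc i)) = basis (suc i)

P : LatticePolytope 20
P = 21 , vertex

fullDimensional : FullDimensional P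
fullDimensional c same (suc i) = begin
  lookup c (suc i)          ≡⟨ basis-· (suc i) c ⟨
  basis (suc i) · c         ≡⟨ ·-comm (basis (suc i)) c ⟩
  c · vertex (suc (suc i))  ≡⟨ same (suc (suc i)) zero ⟩
  c · vertex zero           ≡⟨ ·-zeroʳ c ⟩
  0ℤ                        ∎
  where open ≡-Reasoning
fullDimensional c@(c₀ ∷ c₁ ∷ c₂ ∷ cs) same zero = ℤP.*-cancelʳ-≡ c₀ 0ℤ (+ 3) (begin
  c₀ ℤ.* + 3
    ≡⟨ ℤP.+-identityʳ _ ⟨
  c₀ ℤ.* + 3 ℤ.+ 0ℤ
    ≡⟨ cong (ℤ._+_ (c₀ ℤ.* + 3)) rest≡0 ⟨
  c₀ ℤ.* + 3 ℤ.+ (c₁ ℤ.* -1ℤ ℤ.+ (c₂ ℤ.* -1ℤ ℤ.+ cs · replicate 17 0ℤ))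
    ≡⟨ same (suc zero) zero ⟩
  c · vertex zero
    ≡⟨ ·-zeroʳ c ⟩
  0ℤ
    ∎)
  where
  open ≡-Reasoning
  rest≡0 : c₁ ℤ.* -1ℤ ℤ.+ (c₂ ℤ.* -1ℤ ℤ.+ cs · replicate 17 0ℤ) ≡ 0ℤ
  rest≡0 rewrite fullDimensional c same (suc zero) | fullDimensional c same (suc (suc zero)) | ·-zeroʳ cs
    = refl

-- The facets of nP, and the box they confine the first three coordinates to.
record Bounds (n : ℕ) (x₀ x₁ x₂ : ℤ) (r : Vec ℤ 17) : Set where
  field
    x₀-lower  : 0ℤ ℤ.≤ x₀
    x₀-upper  : x₀ ℤ.≤ + (n ℕ.* 3)
    x₁-lower  : ℤ.- + n ℤ.≤ x₁
    x₁-upper  : x₁ ℤ.≤ + n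
    x₂-lower  : ℤ.- + n ℤ.≤ x₂
    x₂-upper  : x₂ ℤ.≤ + n
    cone₁     : 0ℤ ℤ.≤ x₀ ℤ.+ + 3 ℤ.* x₁
    cone₂     : 0ℤ ℤ.≤ x₀ ℤ.+ + 3 ℤ.* x₂
    r-lower   : ∀ i → 0ℤ ℤ.≤ lookup r i
    sum-upper : Σℤ 20 (lookup (x₀ ∷ x₁ ∷ x₂ ∷ r)) ℤ.≤ + n

dilate⇒Bounds : ∀ {n x₀ x₁ x₂ r} → (x₀ ∷ x₁ ∷ x₂ ∷ r) ∈ n ⊙ P → Bounds n x₀ x₁ x₂ r
dilate⇒Bounds {n} {x₀} {x₁} {x₂} {r} x∈nP = record
  { x₀-lower  = subst (ℤ._≤ x₀) n*0≡0 (coordinate-≥ zero 0ℤ)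
  ; x₀-upper  = subst (x₀ ℤ.≤_) (sym (ℤP.pos-* n 3)) (coordinate-≤ zero (+ 3))
  ; x₁-lower  = subst (ℤ._≤ x₁) n*-1≡-n (coordinate-≥ (suc zero) -1ℤ)
  ; x₁-upper  = subst (x₁ ℤ.≤_) n*1≡n (coordinate-≤ (suc zero) (+ 1))
  ; x₂-lower  = subst (ℤ._≤ x₂) n*-1≡-n (coordinate-≥ (suc (suc zero)) -1ℤ)
  ; x₂-upper  = subst (x₂ ℤ.≤_) n*1≡n (coordinate-≤ (suc (suc zero)) (+ 1))
  ; cone₁     = subst₂ ℤ._≤_ n*0≡0 ·-cone₁ (facet-≥ cone₁-normal 0ℤ)
  ; cone₂     = subst₂ ℤ._≤_ n*0≡0 ·-cone₂ (facet-≥ cone₂-normal 0ℤ)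
  ; r-lower   = λ i → subst₂ ℤ._≤_ n*0≡0 (basis-· (suc (suc (suc i))) x)
                        (·-≥-on-dilate vertex n x x∈nP (basis (suc (suc (suc i)))) (r-facets i))
  ; sum-upper = subst₂ ℤ._≤_ (ones-· x) n*1≡n (facet-≤ (replicate 20 (+ 1)) (+ 1))
  }
  where
  x : Point 20
  x = x₀ ∷ x₁ ∷ x₂ ∷ r

  facet-≤ : ∀ y e → {True (FinP.all? (λ j → y · vertex j ℤP.≤? e))} → y · x ℤ.≤ + n ℤ.* e
  facet-≤ y e {valid} = ·-≤-on-dilate vertex n x x∈nP y (toWitness valid)

  facet-≥ : ∀ y e → {True (FinP.all? (λ j → e ℤP.≤? y · vertex j))} → + n ℤ.* e ℤ.≤ y · x
  facet-≥ y e {valid} = ·-≥-on-dilate vertex n x x∈nP y (toWitness valid)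

  coordinate-≤ : ∀ i e → {True (FinP.all? (λ j → basis i · vertex j ℤP.≤? e))} → lookup x i ℤ.≤ + n ℤ.* e
  coordinate-≤ i e {valid} = subst (ℤ._≤ + n ℤ.* e) (basis-· i x) (facet-≤ (basis i) e {valid})

  coordinate-≥ : ∀ i e → {True (FinP.all? (λ j → e ℤP.≤? basis i · vertex j))} → + n ℤ.* e ℤ.≤ lookup x i
  coordinate-≥ i e {valid} = subst (+ n ℤ.* e ℤ.≤_) (basis-· i x) (facet-≥ (basis i) e {valid})

  r-facets : ∀ i j → 0ℤ ℤ.≤ basis (suc (suc (suc i))) · vertex j
  r-facets = toWitness
    {a? = FinP.all? λ i → FinP.all? λ j → 0ℤ ℤP.≤? basis (suc (suc (suc i))) · vertex j} _

  cone₁-normal cone₂-normal : Point 20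
  cone₁-normal = + 1 ∷ + 3 ∷ 0ℤ ∷ replicate 17 0ℤ
  cone₂-normal = + 1 ∷ 0ℤ ∷ + 3 ∷ replicate 17 0ℤ

  -- The zeros of the normal vectors make their dot products with x compute to the unfolded forms.
  ·-cone₁ : cone₁-normal · x ≡ x₀ ℤ.+ + 3 ℤ.* x₁
  ·-cone₁ = unfolded x₀ x₁
    where
    unfolded : ∀ a b → + 1 ℤ.* a ℤ.+ (+ 3 ℤ.* b ℤ.+ 0ℤ) ≡ a ℤ.+ + 3 ℤ.* b
    unfolded = solve-∀

  ·-cone₂ : cone₂-normal · x ≡ x₀ ℤ.+ + 3 ℤ.* x₂
  ·-cone₂ = unfolded x₀ x₂
    where
    unfolded : ∀ a c → + 1 ℤ.* a ℤ.+ (0ℤ ℤ.+ (+ 3 ℤ.* c ℤ.+ 0ℤ)) ≡ a ℤ.+ + 3 ℤ.* c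
    unfolded = solve-∀

  n*0≡0 : + n ℤ.* 0ℤ ≡ 0ℤ
  n*0≡0 = ℤP.*-zeroʳ (+ n)

  n*1≡n : + n ℤ.* + 1 ≡ + n
  n*1≡n = ℤP.*-identityʳ (+ n)

  n*-1≡-n : + n ℤ.* -1ℤ ≡ ℤ.- + n
  n*-1≡-n = trans (ℤP.*-comm (+ n) -1ℤ) (ℤP.-1*i≡-i (+ n))

Admissible : ℕ → ℤ × ℤ × ℤ → Set
Admissible n (x₀ , x₁ , x₂) =
  0ℤ ℤ.≤ x₀ ℤ.+ + 3 ℤ.* x₁ × 0ℤ ℤ.≤ x₀ ℤ.+ + 3 ℤ.* x₂ × x₀ ℤ.+ (x₁ ℤ.+ x₂) ℤ.≤ + n

admissible? : ∀ n → Decidable (Admissible n)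
admissible? n (x₀ , x₁ , x₂) =
  0ℤ ℤP.≤? x₀ ℤ.+ + 3 ℤ.* x₁ ×-dec 0ℤ ℤP.≤? x₀ ℤ.+ + 3 ℤ.* x₂ ×-dec x₀ ℤ.+ (x₁ ℤ.+ x₂) ℤP.≤? + n

heads : ℕ → List (ℤ × ℤ × ℤ)
heads n = List.filter (admissible? n)
  (cartesianProduct [ 0ℤ ⋯ + (n ℕ.* 3) ] (cartesianProduct [ ℤ.- + n ⋯ + n ] [ ℤ.- + n ⋯ + n ]))

-- The truncation ∣_∣ is harmless: admissible heads have x₀ + x₁ + x₂ ≤ n.
completions : ℕ → ℤ × ℤ × ℤ → List (Point 20)
completions n (x₀ , x₁ , x₂) =
  map (λ r → x₀ ∷ x₁ ∷ x₂ ∷ r) (stdSimplexPoints 17 ℤ.∣ + n ℤ.- (x₀ ℤ.+ (x₁ ℤ.+ x₂)) ∣)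

latticePoints : ℕ → List (Point 20)
latticePoints n = concatMap (completions n) (heads n)

Bounds⇒∈latticePoints : ∀ {n x₀ x₁ x₂ r} → Bounds n x₀ x₁ x₂ r → (x₀ ∷ x₁ ∷ x₂ ∷ r) ∈ latticePoints n
Bounds⇒∈latticePoints {n} {x₀} {x₁} {x₂} {r} bounds =
  ∈-concatMap⁺ (completions n) (lose head∈heads (∈-map⁺ (λ r → x₀ ∷ x₁ ∷ x₂ ∷ r) r∈stdSimplexPoints))
  where
  open Bounds bounds
  s : ℤ
  s = x₀ ℤ.+ (x₁ ℤ.+ x₂)

  s+Σr≤n : s ℤ.+ Σℤ 17 (lookup r) ℤ.≤ + n
  s+Σr≤n = subst (ℤ._≤ + n) (reassociate x₀ x₁ x₂ _) sum-upper
    where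
    reassociate : ∀ a b c t → a ℤ.+ (b ℤ.+ (c ℤ.+ t)) ≡ a ℤ.+ (b ℤ.+ c) ℤ.+ t
    reassociate = solve-∀

  s≤n : s ℤ.≤ + n
  s≤n = ℤP.≤-trans (ℤP.i≤i+j s _ {{ℤ.nonNegative (Σℤ-nonNeg 17 r-lower)}}) s+Σr≤n

  head∈heads : (x₀ , x₁ , x₂) ∈ heads n
  head∈heads = ∈-filter⁺ (admissible? n)
    (∈-cartesianProduct⁺ (∈-[⋯] x₀-lower x₀-upper)
      (∈-cartesianProduct⁺ (∈-[⋯] x₁-lower x₁-upper) (∈-[⋯] x₂-lower x₂-upper)))
    (cone₁ , cone₂ , s≤n)

  r∈stdSimplexPoints : r ∈ stdSimplexPoints 17 ℤ.∣ + n ℤ.- s ∣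
  r∈stdSimplexPoints = ∈-stdSimplexPoints r-lower
    (subst (Σℤ 17 (lookup r) ℤ.≤_) (sym (ℤP.0≤i⇒+∣i∣≡i (ℤP.i≤j⇒0≤j-i s≤n))) (i+j≤k⇒j≤k-i {s} s+Σr≤n))

dilate⊆latticePoints : ∀ n {x} → x ∈ n ⊙ P → x ∈ latticePoints n
dilate⊆latticePoints n {x₀ ∷ x₁ ∷ x₂ ∷ r} x∈nP = Bounds⇒∈latticePoints (dilate⇒Bounds {n} x∈nP)

-- 3n times the barycentric coordinates of x with respect to the vertices n · vertex j of nP.
scaledBarycentric : ℕ → Point 20 → Vec ℤ 21
scaledBarycentric n x@(x₀ ∷ x₁ ∷ x₂ ∷ r) =
  + 3 ℤ.* (+ n ℤ.- Σℤ 20 (lookup x)) ∷ x₀ ∷ (x₀ ℤ.+ + 3 ℤ.* x₁) ∷ (x₀ ℤ.+ + 3 ℤ.* x₂) ∷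
  Vec.map (ℤ._*_ (+ 3)) r

latticePoints-2⊆2P : ∀ {x} → x ∈ latticePoints 2 → x ∈ 2 ⊙ P
latticePoints-2⊆2P {x} x∈ =
  ∈⊙-intro vertex 2 6 (+ 1 ℚ./ 6) (ℚP.nonNegative⁻¹ _) refl x _ (All.lookup certificates x∈)
  where
  Certified : Point 20 → Set
  Certified x = ScaledConvexCombination vertex 2 6 x (lookup (scaledBarycentric 2 x))
  certified? : Decidable Certified
  certified? x = scaledConvexCombination? vertex 2 6 x (lookup (scaledBarycentric 2 x))
  certificates : All Certified (latticePoints 2)
  certificates = toWitness {a? = All.all? certified? (latticePoints 2)} _

latticePoints-2-unique : Unique (latticePoints 2)
latticePoints-2-unique = toWitness {a? = unique? (latticePoints 2)} _
  where open import Data.List.Relation.Unary.Unique.DecPropositional (VecP.≡-dec ℤ._≟_) using (unique?)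

testVector : Point 20
testVector = + 1 ∷ + 1 ∷ + 1 ∷ -1ℤ ∷ -1ℤ ∷ -1ℤ ∷ replicate 14 0ℤ

-- The coefficients of 1, t, t², t³ in (1 − t)²³.
binomials23 : Vec ℤ 4
binomials23 = + 1 ∷ ℤ.- + 23 ∷ + 253 ∷ ℤ.- + 1771 ∷ []

h2₃-expansion : ∀ {d} (L : ℕ → Matrix d) a b →
  h2 20 L 3 a b ≡ Σℤ 4 (λ j → lookup binomials23 j ℤ.* L (3 ∸ toℕ j) a b)
h2₃-expansion L a b = refl

h2₃-expansion-negative : (q : ℕ → ℤ) → 0ℤ ℤ.≤ q 0 → q 1 ℤ.≤ + 7 → + 169 ℤ.≤ q 2 → q 3 ℤ.≤ + 2115 →
  Σℤ 4 (λ j → lookup binomials23 j ℤ.* q (3 ∸ toℕ j)) ℤ.≤ -1ℤ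
h2₃-expansion-negative q q₀≥0 q₁≤7 q₂≥169 q₃≤2115 = begin
  Σℤ 4 (λ j → lookup binomials23 j ℤ.* q (3 ∸ toℕ j))
    ≡⟨⟩
  + 1 ℤ.* q 3 ℤ.+ (ℤ.- + 23 ℤ.* q 2 ℤ.+ (+ 253 ℤ.* q 1 ℤ.+ (ℤ.- + 1771 ℤ.* q 0 ℤ.+ 0ℤ)))
    ≤⟨ ℤP.+-mono-≤ (ℤP.*-monoˡ-≤-nonNeg (+ 1) q₃≤2115)
         (ℤP.+-mono-≤ (ℤP.*-monoˡ-≤-nonPos (ℤ.- + 23) q₂≥169)
           (ℤP.+-mono-≤ (ℤP.*-monoˡ-≤-nonNeg (+ 253) q₁≤7)
             (ℤP.+-monoˡ-≤ 0ℤ (ℤP.*-monoˡ-≤-nonPos (ℤ.- + 1771) q₀≥0)))) ⟩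
  + 1 ℤ.* + 2115 ℤ.+ (ℤ.- + 23 ℤ.* + 169 ℤ.+ (+ 253 ℤ.* + 7 ℤ.+ (ℤ.- + 1771 ℤ.* 0ℤ ℤ.+ 0ℤ)))
    ≡⟨⟩
  -1ℤ
    ∎
  where open ℤP.≤-Reasoning

module _ (L : ℕ → Matrix 20) (L≡L²nP : ∀ n → IsL2 P n (L n)) where
  private
    q : ℕ → ℤ
    q n = quadForm (L n) testVector

  q₀-lower : 0ℤ ℤ.≤ q 0
  q₀-lower = quadForm-L²-≥ P 0 (L≡L²nP 0) testVector [] (λ ())

  q₁-upper : q 1 ℤ.≤ + 7
  q₁-upper = quadForm-L²-≤ P 1 (L≡L²nP 1) testVector (dilate⊆latticePoints 1)

  q₂-lower : + 169 ℤ.≤ q 2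
  q₂-lower = quadForm-L²-≥ P 2 (L≡L²nP 2) testVector latticePoints-2-unique latticePoints-2⊆2P

  q₃-upper : q 3 ℤ.≤ + 2115
  q₃-upper = quadForm-L²-≤ P 3 (L≡L²nP 3) testVector (dilate⊆latticePoints 3)

  quadForm-h2₃ : quadForm (h2 20 L 3) testVector ≡ Σℤ 4 (λ j → lookup binomials23 j ℤ.* q (3 ∸ toℕ j))
  quadForm-h2₃ = trans (quadForm-cong testVector (h2₃-expansion L))
    (quadForm-Σ testVector 4 (lookup binomials23) (λ j → L (3 ∸ toℕ j)))

  h2₃-not-PSD : ¬ PSD (h2 20 L 3)
  h2₃-not-PSD psd = contradiction (ℤP.≤-trans (psd testVector) quadForm-h2₃≤-1) λ ()
    where
    quadForm-h2₃≤-1 : quadForm (h2 20 L 3) testVector ℤ.≤ -1ℤ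
    quadForm-h2₃≤-1 = subst (ℤ._≤ -1ℤ) (sym quadForm-h2₃)
      (h2₃-expansion-negative q q₀-lower q₁-upper q₂-lower q₃-upper)

corollary4p4 : Σ (LatticePolytope 20) λ P →
    FullDimensional P ×
    ((L : ℕ → Matrix 20) → ((n : ℕ) → IsL2 P n (L n)) →
      Σ ℕ λ i → ¬ PSD (h2 20 L i))
corollary4p4 = P , fullDimensional , λ L L≡L²nP → 3 , h2₃-not-PSD L L≡L²nP
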